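{- Let $d$ be a positive integer and $\preceq$ a relaxed monomial order on $\mathbb{N}^d$. If $S\in\operatorname{R}_\preceq(\mathcal{S}_d)$ and $S\neq\mathbb{N}^d$, then $$\min_\preceq\operatorname{H}(S)=\min_\preceq\big(\mathbb{N}^d\setminus\{\mathbf{0}\}\big)=\min_\preceq\{\mathbf{e}_1,\ldots,\mathbf{e}_d\}.$$
   Context: $\mathbf{e}_1,\ldots,\mathbf{e}_d$ are the standard basis vectors of $\mathbb{R}^d$. A generalized numerical semigroup (GNS) in $\mathbb{N}^d$ is a submonoid $S$ of $(\mathbb{N}^d,+)$ with $\operatorname{H}(S)=\mathbb{N}^d\setminus S$ finite; $|\operatorname{H}(S)|$ is its genus; $\mathcal{S}_d$ is the set of GNSs in $\mathbb{N}^d$ and $\mathcal{S}_{g,d}$ those of genus $g$. $\operatorname{P}_d$ is the set of permutations of $\{1,\ldots,d\}$, acting by $\sigma(\sum x_i\mathbf{e}_i)=\sum x_i\mathbf{e}_{\sigma(i)}$ and elementwise on sets; $[S]_\simeq=\{\sigma(S)\mid\sigma\in\operatorname{P}_d\}$. A relaxed monomial order is a total order $\preceq$ on $\mathbb{N}^d$ with $\mathbf{0}\preceq\mathbf{v}$ for all $\mathbf{v}$ and such that $\mathbf{v}\prec\mathbf{w}$ implies $\mathbf{v}\prec\mathbf{w}+\mathbf{u}$ for all $\mathbf{u}$. For $S,S'\in\mathcal{S}_{g,d}$ with gaps $\mathbf{h}_1\prec\cdots\prec\mathbf{h}_g$ and $\mathbf{h}'_1\prec\cdots\prec\mathbf{h}'_g$,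 $S\preceq_{\operatorname{R}}S'$ means $S=S'$ or $\mathbf{h}_r\prec\mathbf{h}'_r$ for $r=\min\{i\mid\mathbf{h}_i\neq\mathbf{h}'_i\}$; $\operatorname{R}_\preceq(S)=\min_{\preceq_{\operatorname{R}}}[S]_\simeq$ and $\operatorname{R}_\preceq(\mathcal{S}_d)=\{\operatorname{R}_\preceq(S)\mid S\in\mathcal{S}_d\}$. -}

module Defs where

open import Data.Nat using (ℕ; zero; suc; _+_; _≤_)
open import Data.Fin using (Fin)
open import Data.Fin.Permutation using (Permutation′; _⟨$⟩ˡ_)
open import Data.Vec using (Vec; replicate; zipWith; tabulate; lookup)
open import Data.List using (List; []; _∷_)
open import Data.List.Membership.Propositional using (_∈_)
open import Data.List.Relation.Unary.Linked using (Linked)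
open import Data.Product using (Σ; ∃; _×_; _,_)
open import Relation.Nullary using (¬_)
open import Relation.Binary.PropositionalEquality using (_≡_; _≢_)
open import Relation.Binary.Structures using (IsTotalOrder)

ℕ^ : ℕ → Set
ℕ^ d = Vec ℕ d

𝟎 : ∀ {d} → ℕ^ d
𝟎 = replicate _ 0

_⊕_ : ∀ {d} → ℕ^ d → ℕ^ d → ℕ^ d
_⊕_ = zipWith _+_

e : ∀ {d} → Fin d → ℕ^ d
e i = tabulate (λ j → δ i j)
  where
  open import Data.Fin using (_≟_)
  open import Relation.Nullary using (yes; no)
  δ : ∀ {d} → Fin d → Fin d → ℕ
  δ i j with i ≟ j
  ... | yes _ = 1
  ... | no _ = 0

SubsetN : ℕ → Set₁
SubsetN d = ℕ^ d → Set

_≐_ : ∀ {d} → SubsetN d → SubsetN d → Set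
A ≐ B = ∀ v → (A v → B v) × (B v → A v)

record IsRelaxedMonomialOrder {d : ℕ} (_≼_ : ℕ^ d → ℕ^ d → Set) : Set where
  field
    isTotalOrder : IsTotalOrder _≡_ _≼_
    zero-least   : ∀ v → 𝟎 ≼ v
    strict-mono  : ∀ v w u → (v ≼ w × v ≢ w) → ((v ≼ (w ⊕ u)) × v ≢ (w ⊕ u))

record IsGNS {d : ℕ} (S : SubsetN d) : Set where
  field
    zero∈   : S 𝟎
    closed  : ∀ u v → S u → S v → S (u ⊕ v)
    finiteH : ∃ λ (H : List (ℕ^ d)) → ∀ v → ((¬ S v) → v ∈ H) × (v ∈ H → ¬ S v)

-- Action of a permutation: σ(Σ x_i e_i) = Σ x_i e_{σ(i)}, i.e. σ(x)_j = x_{σ⁻¹(j)}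
act : ∀ {d} → Permutation′ d → ℕ^ d → ℕ^ d
act σ x = tabulate (λ j → lookup x (σ ⟨$⟩ˡ j))

actSet : ∀ {d} → Permutation′ d → SubsetN d → SubsetN d
actSet σ S w = ∃ λ v → S v × w ≡ act σ v

module _ {d : ℕ} (_≼_ : ℕ^ d → ℕ^ d → Set) where

  _≺_ : ℕ^ d → ℕ^ d → Set
  v ≺ w = v ≼ w × v ≢ w

  SortedGaps : SubsetN d → List (ℕ^ d) → Set
  SortedGaps S hs = Linked _≺_ hs × (∀ v → ((¬ S v) → v ∈ hs) × (v ∈ hs → ¬ S v))

  data LexR : List (ℕ^ d) → List (ℕ^ d) → Set where
    done  : LexR [] []
    here  : ∀ {x y xs ys} → x ≺ y → LexR (x ∷ xs) (y ∷ ys)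
    there : ∀ {x xs ys} → LexR xs ys → LexR (x ∷ xs) (x ∷ ys)

  _⪯R_ : SubsetN d → SubsetN d → Set
  S ⪯R S' = ∃ λ hs → ∃ λ hs' → SortedGaps S hs × SortedGaps S' hs' × LexR hs hs'

  IsRMin : SubsetN d → SubsetN d → Set
  IsRMin S T = (∃ λ σ → T ≐ actSet σ S) × (∀ σ → T ⪯R actSet σ S)

  InR : SubsetN d → Set₁
  InR T = Σ (SubsetN d) λ S → IsGNS S × IsRMin S T

  IsMin : (ℕ^ d → Set) → ℕ^ d → Set
  IsMin P m = P m × (∀ v → P v → m ≼ v)

{-# OPTIONS --safe #-}

-- Let e i be the ≼-least basis vector. Every nonzero v is e k ⊕ u, so e i ≼ e k ≼ v by
-- monotonicity, and it remains to see that e i is a gap of S. If it were not, some e j is a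
-- gap (else the basis vectors, hence all of ℕ^d, lie in S); swapping coordinates i and j
-- gives a conjugate S′ of S with gap e i. As 𝟎 ∈ S, the first gap h of S is nonzero, so
-- e i ≼ h, while the first gap h′ of S′ satisfies h′ ≼ e i. Minimality S ⪯R S′ gives h ≼ h′,
-- so h = e i is a gap of S after all. The gap e j is only obtained doubly negated, which is
-- enough because the goal is a negation.
module Submission where

open import Defs
open import Data.Nat using (ℕ; zero; suc; _≤_; _+_) renaming (_≟_ to _≟ℕ_)
open import Data.Nat.Properties using (+-identityˡ; +-identityʳ)
open import Data.Fin using (Fin; zero; suc; _≟_)
open import Data.Fin.Properties using (suc-injective; sequence)
open import Data.Fin.Permutation using (Permutation′; _⟨$⟩ˡ_; _⟨$⟩ʳ_; _∘ₚ_; transpose; inverseˡ; inverseʳ)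
open import Data.Vec using (_∷_; []; lookup)
open import Data.Vec.Properties using (lookup∘tabulate; lookup-replicate; lookup-zipWith; zipWith-identityˡ; ≡-dec)
open import Data.Vec.Relation.Binary.Pointwise.Extensional using (ext; Pointwise-≡⇒≡)
open import Data.List using ([]; _∷_)
open import Data.List.Membership.Propositional using (_∈_)
open import Data.List.Relation.Unary.Any using (here)
import Data.List.Relation.Unary.All as All
open import Data.List.Relation.Unary.Linked as Linked using (Linked)
open import Data.List.Relation.Unary.Linked.Properties using (Linked⇒All)
open import Data.Product using (∃; ∃₂; _×_; _,_; proj₁; proj₂)
open import Data.Sum using (inj₁; inj₂)
open import Effect.Monad using (RawMonad)
open import Function using (_∘_; _∋_)
open import Relation.Nullary using (¬_; yes; no; contradiction)
open import Relation.Nullary.Decidable using (dec-true)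
open import Relation.Nullary.Negation using (¬¬-Monad)
open import Relation.Binary.PropositionalEquality using (_≡_; _≢_; refl; sym; trans; cong; cong₂; subst; module ≡-Reasoning)
open import Relation.Binary.Structures using (IsTotalOrder)

private
  variable
    d n : ℕ

≡-lookup : {u v : ℕ^ d} → (∀ k → lookup u k ≡ lookup v k) → u ≡ v
≡-lookup u≗v = Pointwise-≡⇒≡ (ext u≗v)

lookup-𝟎 : (k : Fin d) → lookup 𝟎 k ≡ 0
lookup-𝟎 k = lookup-replicate k 0

lookup-⊕ : (u v : ℕ^ d) (k : Fin d) → lookup (u ⊕ v) k ≡ lookup u k + lookup v k
lookup-⊕ u v k = lookup-zipWith _+_ k u v

⊕-identityˡ : (v : ℕ^ d) → 𝟎 ⊕ v ≡ v
⊕-identityˡ = zipWith-identityˡ +-identityˡ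

lookup-e-≡ : (i j : Fin d) → i ≡ j → lookup (e i) j ≡ 1
lookup-e-≡ i j i≡j rewrite (lookup (e i) j ≡ _ ∋ lookup∘tabulate _ j) with i ≟ j
... | yes _   = refl
... | no i≢j  = contradiction i≡j i≢j

lookup-e-≢ : (i j : Fin d) → i ≢ j → lookup (e i) j ≡ 0
lookup-e-≢ i j i≢j rewrite (lookup (e i) j ≡ _ ∋ lookup∘tabulate _ j) with i ≟ j
... | yes i≡j = contradiction i≡j i≢j
... | no _    = refl

lookup-e-cong : (i j : Fin d) (i′ j′ : Fin n) →
                (i ≡ j → i′ ≡ j′) → (i′ ≡ j′ → i ≡ j) → lookup (e i) j ≡ lookup (e i′) j′
lookup-e-cong i j i′ j′ to from with i ≟ j
... | yes i≡j = trans (lookup-e-≡ i j i≡j) (sym (lookup-e-≡ i′ j′ (to i≡j)))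
... | no i≢j  = trans (lookup-e-≢ i j i≢j) (sym (lookup-e-≢ i′ j′ (i≢j ∘ from)))

e≢𝟎 : (i : Fin d) → e i ≢ 𝟎
e≢𝟎 i e≡𝟎 with trans (sym (lookup-e-≡ i i refl)) (trans (cong (λ v → lookup v i) e≡𝟎) (lookup-𝟎 i))
... | ()

e-zero : e {suc n} zero ≡ 1 ∷ 𝟎
e-zero {n} = ≡-lookup λ where
  zero    → lookup-e-≡ {suc n} zero zero refl
  (suc k) → trans (lookup-e-≢ zero (suc k) λ ()) (sym (lookup-𝟎 k))

e-suc : (i : Fin n) → e (suc i) ≡ 0 ∷ e i
e-suc i = ≡-lookup λ where
  zero    → lookup-e-≢ (suc i) zero λ ()
  (suc k) → lookup-e-cong (suc i) (suc k) i k suc-injective (cong suc)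

e-zero-⊕ : (x : ℕ) (xs : ℕ^ n) → e zero ⊕ (x ∷ xs) ≡ suc x ∷ xs
e-zero-⊕ x xs = trans (cong (_⊕ (x ∷ xs)) e-zero) (cong (suc x ∷_) (⊕-identityˡ xs))

nonzero-split : (v : ℕ^ d) → v ≢ 𝟎 → ∃₂ λ k u → v ≡ e k ⊕ u
nonzero-split []           v≢𝟎 = contradiction refl v≢𝟎
nonzero-split (suc x ∷ xs) _   = zero , x ∷ xs , sym (e-zero-⊕ x xs)
nonzero-split (zero ∷ xs)  v≢𝟎 with nonzero-split xs (v≢𝟎 ∘ cong (0 ∷_))
... | k , u , xs≡ek⊕u = suc k , 0 ∷ u , trans (cong (0 ∷_) xs≡ek⊕u) (sym (cong (_⊕ (0 ∷ u)) (e-suc k)))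

basis-generates : (P : ℕ^ d → Set) → P 𝟎 → (∀ u v → P u → P v → P (u ⊕ v)) →
                  (∀ k → P (e k)) → ∀ v → P v
basis-generates P P𝟎 P⊕ Pe []       = P𝟎
basis-generates P P𝟎 P⊕ Pe (x ∷ xs) =
  subst P (cong₂ _∷_ (+-identityʳ x) (⊕-identityˡ xs)) (P⊕ _ _ (P-axis x) P-tail)
  where
  P-axis : ∀ x → P (x ∷ 𝟎)
  P-axis zero    = P𝟎
  P-axis (suc x) = subst P (e-zero-⊕ x 𝟎) (P⊕ _ _ (Pe zero) (P-axis x))

  P-tail : P (0 ∷ xs)
  P-tail = basis-generates (P ∘ (0 ∷_)) P𝟎 (λ u v → P⊕ (0 ∷ u) (0 ∷ v))
                           (λ k → subst P (e-suc k) (Pe (suc k))) xs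

lookup-act : (σ : Permutation′ d) (x : ℕ^ d) (k : Fin d) → lookup (act σ x) k ≡ lookup x (σ ⟨$⟩ˡ k)
lookup-act σ x k = lookup∘tabulate _ k

lookup-act-⟨$⟩ʳ : (σ : Permutation′ d) (x : ℕ^ d) (k : Fin d) → lookup (act σ x) (σ ⟨$⟩ʳ k) ≡ lookup x k
lookup-act-⟨$⟩ʳ σ x k = trans (lookup-act σ x (σ ⟨$⟩ʳ k)) (cong (lookup x) (inverseˡ σ))

act-𝟎 : (σ : Permutation′ d) → act σ 𝟎 ≡ 𝟎
act-𝟎 σ = ≡-lookup λ k → trans (lookup-act σ 𝟎 k) (trans (lookup-𝟎 (σ ⟨$⟩ˡ k)) (sym (lookup-𝟎 k)))

act-⊕ : (σ : Permutation′ d) (u v : ℕ^ d) → act σ (u ⊕ v) ≡ act σ u ⊕ act σ v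
act-⊕ σ u v = ≡-lookup λ k → begin
  lookup (act σ (u ⊕ v)) k                         ≡⟨ lookup-act σ (u ⊕ v) k ⟩
  lookup (u ⊕ v) (σ ⟨$⟩ˡ k)                        ≡⟨ lookup-⊕ u v (σ ⟨$⟩ˡ k) ⟩
  lookup u (σ ⟨$⟩ˡ k) + lookup v (σ ⟨$⟩ˡ k)        ≡⟨ sym (cong₂ _+_ (lookup-act σ u k) (lookup-act σ v k)) ⟩
  lookup (act σ u) k + lookup (act σ v) k          ≡⟨ sym (lookup-⊕ (act σ u) (act σ v) k) ⟩
  lookup (act σ u ⊕ act σ v) k                     ∎
  where open ≡-Reasoning

act-∘ₚ : (σ π : Permutation′ d) (x : ℕ^ d) → act (σ ∘ₚ π) x ≡ act π (act σ x)
act-∘ₚ σ π x = ≡-lookup λ k →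
  trans (lookup-act (σ ∘ₚ π) x k) (sym (trans (lookup-act π (act σ x) k) (lookup-act σ x (π ⟨$⟩ˡ k))))

act-injective : (σ : Permutation′ d) {u v : ℕ^ d} → act σ u ≡ act σ v → u ≡ v
act-injective σ {u} {v} σu≡σv = ≡-lookup λ k → begin
  lookup u k                   ≡⟨ sym (lookup-act-⟨$⟩ʳ σ u k) ⟩
  lookup (act σ u) (σ ⟨$⟩ʳ k)  ≡⟨ cong (λ w → lookup w (σ ⟨$⟩ʳ k)) σu≡σv ⟩
  lookup (act σ v) (σ ⟨$⟩ʳ k)  ≡⟨ lookup-act-⟨$⟩ʳ σ v k ⟩
  lookup v k                   ∎
  where open ≡-Reasoning

act-e : (σ : Permutation′ d) (i : Fin d) → act σ (e i) ≡ e (σ ⟨$⟩ʳ i)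
act-e σ i = ≡-lookup λ k → trans (lookup-act σ (e i) k)
  (lookup-e-cong i (σ ⟨$⟩ˡ k) (σ ⟨$⟩ʳ i) k (λ { refl → inverseʳ σ }) (λ { refl → sym (inverseˡ σ) }))

transpose-matchˡ : (i j : Fin d) → transpose i j ⟨$⟩ʳ i ≡ j
transpose-matchˡ i j rewrite dec-true (i ≟ i) refl = refl

actSet-𝟎 : (σ : Permutation′ d) {S : SubsetN d} → S 𝟎 → actSet σ S 𝟎
actSet-𝟎 σ S𝟎 = 𝟎 , S𝟎 , sym (act-𝟎 σ)

actSet-⊕ : (σ : Permutation′ d) {S : SubsetN d} → (∀ u v → S u → S v → S (u ⊕ v)) →
           ∀ u v → actSet σ S u → actSet σ S v → actSet σ S (u ⊕ v)
actSet-⊕ σ S⊕ _ _ (u , Su , refl) (v , Sv , refl) = u ⊕ v , S⊕ u v Su Sv , sym (act-⊕ σ u v)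

actSet-∘ₚ : (σ π : Permutation′ d) {S : SubsetN d} {w : ℕ^ d} →
            actSet (σ ∘ₚ π) S (act π w) → actSet σ S w
actSet-∘ₚ σ π (v , Sv , πw≡) = v , Sv , act-injective π (trans πw≡ (act-∘ₚ σ π v))

¬¬-∀-Fin : {P : Fin n → Set} → (∀ k → ¬ ¬ P k) → ¬ ¬ (∀ k → P k)
¬¬-∀-Fin = sequence (RawMonad.rawApplicative ¬¬-Monad)

proper⇒¬∀¬¬e∈ : {T : SubsetN d} → T 𝟎 → (∀ u v → T u → T v → T (u ⊕ v)) →
                ¬ (∀ v → T v) → ¬ (∀ k → ¬ ¬ T (e k))
proper⇒¬∀¬¬e∈ {T = T} T𝟎 T⊕ T≠ℕ^d ¬¬Te = ¬¬-∀-Fin ¬¬Te (T≠ℕ^d ∘ basis-generates T T𝟎 T⊕)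

module RelaxedMonomialOrder {_≼_ : ℕ^ d → ℕ^ d → Set} (≼-order : IsRelaxedMonomialOrder _≼_) where
  open IsRelaxedMonomialOrder ≼-order
  open IsTotalOrder isTotalOrder using (total; antisym) renaming (refl to ≼-refl; trans to ≼-trans)

  v≼v⊕w : ∀ v w → v ≼ (v ⊕ w)
  -- If v ⊕ w ≺ v, strict monotonicity applied with u := w would give v ⊕ w ≺ v ⊕ w.
  v≼v⊕w v w with total v (v ⊕ w) | ≡-dec _≟ℕ_ (v ⊕ w) v
  ... | inj₁ v≼v⊕w | _           = v≼v⊕w
  ... | inj₂ _     | yes v⊕w≡v  = subst (v ≼_) (sym v⊕w≡v) ≼-refl
  ... | inj₂ v⊕w≼v | no v⊕w≢v   = contradiction refl (proj₂ (strict-mono (v ⊕ w) v w (v⊕w≼v , v⊕w≢v)))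

  argmin : (f : Fin (suc n) → ℕ^ d) → ∃ λ i → ∀ k → f i ≼ f k
  argmin {n = zero}  f = zero , λ { zero → ≼-refl }
  argmin {n = suc n} f with argmin (f ∘ suc)
  ... | i , fsuci≼ with total (f zero) (f (suc i))
  ...   | inj₁ f0≼ = zero , λ { zero → ≼-refl ; (suc k) → ≼-trans f0≼ (fsuci≼ k) }
  ...   | inj₂ ≼f0 = suc i , λ { zero → ≼f0 ; (suc k) → fsuci≼ k }

  least-basis≼nonzero : {i : Fin d} → (∀ k → e i ≼ e k) → ∀ v → v ≢ 𝟎 → e i ≼ v
  least-basis≼nonzero ei≼ v v≢𝟎 with nonzero-split v v≢𝟎
  ... | k , u , refl = ≼-trans (ei≼ k) (v≼v⊕w (e k) u)

  head≼ : ∀ {x y xs} → Linked (_≺_ _≼_) (x ∷ xs) → y ∈ x ∷ xs → x ≼ y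
  head≼ sorted = All.lookup (Linked⇒All ≼-trans ≼-refl (Linked.map proj₁ sorted))

  LexR-head≼ : ∀ {x y xs ys} → LexR _≼_ (x ∷ xs) (y ∷ ys) → x ≼ y
  LexR-head≼ (LexR.here x≺y) = proj₁ x≺y
  LexR-head≼ (LexR.there _)  = ≼-refl

  ⪯R-gap : {T T′ : SubsetN d} {m : ℕ^ d} → T 𝟎 → (∀ v → v ≢ 𝟎 → m ≼ v) →
           _⪯R_ _≼_ T T′ → ¬ T′ m → ¬ T m
  ⪯R-gap _ _ (_ , [] , _ , (_ , gaps′) , _) m∉T′ with proj₁ (gaps′ _) m∉T′
  ... | ()
  ⪯R-gap _ _ ([] , _ ∷ _ , _ , _ , ()) _
  ⪯R-gap {T = T} {m = m} T𝟎 m≼nonzero (h ∷ _ , h′ ∷ _ , (_ , gaps) , (sorted′ , gaps′) , lex) m∉T′ =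
    subst (¬_ ∘ T) (antisym h≼m m≼h) h∉T
    where
    h∉T : ¬ T h
    h∉T = proj₂ (gaps h) (here refl)
    h≼m : h ≼ m
    h≼m = ≼-trans (LexR-head≼ lex) (head≼ sorted′ (proj₁ (gaps′ m) m∉T′))
    m≼h : m ≼ h
    m≼h = m≼nonzero h λ { refl → h∉T T𝟎 }

mainTheorem19 : (d : ℕ) → 1 ≤ d → (_≼_ : ℕ^ d → ℕ^ d → Set) → IsRelaxedMonomialOrder _≼_
    → (S : SubsetN d) → InR _≼_ S → ¬ (∀ v → S v)
    → ∃ λ m → IsMin _≼_ (λ v → ¬ S v) m × IsMin _≼_ (λ v → v ≢ 𝟎) m
        × IsMin _≼_ (λ v → ∃ λ (i : Fin d) → v ≡ e i) m
mainTheorem19 zero () _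
mainTheorem19 (suc n) _ _≼_ ≼-order T (S , S-gns , (σ , T≐σS) , T-least) T≠ℕ^d =
  e i , (ei∉T , λ v v∉T → ei≼nonzero v λ { refl → v∉T T𝟎 }) , (e≢𝟎 i , ei≼nonzero)
      , ((i , refl) , λ { _ (k , refl) → ei≼ek k })
  where
  open RelaxedMonomialOrder ≼-order
  open IsGNS S-gns

  T𝟎 : T 𝟎
  T𝟎 = proj₂ (T≐σS 𝟎) (actSet-𝟎 σ zero∈)

  T⊕ : ∀ u v → T u → T v → T (u ⊕ v)
  T⊕ u v Tu Tv = proj₂ (T≐σS _) (actSet-⊕ σ closed u v (proj₁ (T≐σS u) Tu) (proj₁ (T≐σS v) Tv))

  i : Fin (suc n)
  i = proj₁ (argmin e)

  ei≼ek : ∀ k → e i ≼ e k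
  ei≼ek = proj₂ (argmin e)

  ei≼nonzero : ∀ v → v ≢ 𝟎 → e i ≼ v
  ei≼nonzero = least-basis≼nonzero ei≼ek

  swapped-gap : ∀ j → ¬ T (e j) → ¬ actSet (σ ∘ₚ transpose j i) S (e i)
  swapped-gap j ej∉T = ej∉T ∘ proj₂ (T≐σS _) ∘ actSet-∘ₚ σ π ∘ subst (actSet (σ ∘ₚ π) S) (sym πej≡ei)
    where
    π : Permutation′ (suc n)
    π = transpose j i
    πej≡ei : act π (e j) ≡ e i
    πej≡ei = trans (act-e π j) (cong e (transpose-matchˡ j i))

  ei∉T : ¬ T (e i)
  ei∉T Tei = proper⇒¬∀¬¬e∈ T𝟎 T⊕ T≠ℕ^d λ j ej∉T →
    ⪯R-gap T𝟎 ei≼nonzero (T-least (σ ∘ₚ transpose j i)) (swapped-gap j ej∉T) Tei
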